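{- Let $G$ be a graph with minimum degree $\delta(G)\geq 3$. Then $\mathrm{dim}(G)<2c(G)-1$ and $\mathrm{edim}(G)<2c(G)-1$.
   Context: All graphs are finite, simple and connected. The cyclomatic number is $c(G)=|E(G)|-|V(G)|+1$. For vertices $u,v$, $d(u,v)$ is the length of a shortest $u$–$v$ path; for a vertex $u$ and an edge $e=vw$, $d(u,e)=\min\{d(u,v),d(u,w)\}$. A set $S\subseteq V(G)$ is a vertex (resp. edge) metric generator if for every pair of distinct vertices (resp. edges) $x,x'$ there is $s\in S$ with $d(s,x)\neq d(s,x')$. $\mathrm{dim}(G)$ (resp. $\mathrm{edim}(G)$) is the minimum size of a vertex (resp. edge) metric generator. -}

module Defs where

open import Data.Nat using (ℕ; zero; suc; _+_; _∸_; _≤_; _<_; _⊓_; _<ᵇ_)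
open import Data.Nat.ListAction using (sum)
open import Data.Bool using (Bool; true; false; _∧_)
open import Data.Fin using (Fin; toℕ)
open import Data.Fin.Subset using (Subset; _∈_; ∣_∣)
open import Data.Vec using (tabulate)
open import Data.List using (map; allFin)
open import Data.Product using (Σ; ∃; ∃-syntax; _×_; _,_; proj₁; proj₂)
open import Relation.Binary.PropositionalEquality using (_≡_; _≢_)

record Graph : Set where
  field
    n     : ℕ
    adj   : Fin n → Fin n → Bool
    sym   : ∀ u v → adj u v ≡ adj v u
    irrfl : ∀ v → adj v v ≡ false

open Graph public

Vertex : Graph → Set
Vertex G = Fin (n G)

data Walk (G : Graph) : Vertex G → Vertex G → ℕ → Set where
  nil  : ∀ {u} → Walk G u u zero
  cons : ∀ {u w v k} → adj G u w ≡ true → Walk G w v k → Walk G u v (suc k)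

Connected : Graph → Set
Connected G = ∀ (u v : Vertex G) → ∃[ k ] Walk G u v k

Dist : (G : Graph) → Vertex G → Vertex G → ℕ → Set
Dist G u v k = Walk G u v k × (∀ m → Walk G u v m → k ≤ m)

nbhd : (G : Graph) → Vertex G → Subset (n G)
nbhd G v = tabulate (adj G v)

degree : (G : Graph) → Vertex G → ℕ
degree G v = ∣ nbhd G v ∣

numEdges : Graph → ℕ
numEdges G = sum (map (λ i → ∣ tabulate (λ j → adj G i j ∧ (toℕ i <ᵇ toℕ j)) ∣) (allFin (n G)))

-- Cyclomatic number c(G) = |E| - |V| + 1 (nonnegative for connected G).
cyclomatic : Graph → ℕ
cyclomatic G = (numEdges G + 1) ∸ n G

record Edge (G : Graph) : Set where
  constructor edge
  field
    fst  : Vertex G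
    snd  : Vertex G
    ord  : (toℕ fst <ᵇ toℕ snd) ≡ true
    isAdj : adj G fst snd ≡ true

DistinctEdges : (G : Graph) → Edge G → Edge G → Set
DistinctEdges G e e' = (Edge.fst e , Edge.snd e) ≢ (Edge.fst e' , Edge.snd e')

EDist : (G : Graph) → Vertex G → Edge G → ℕ → Set
EDist G u e k = ∃[ a ] ∃[ b ] (Dist G u (Edge.fst e) a × Dist G u (Edge.snd e) b × k ≡ a ⊓ b)

IsVertexMetricGenerator : (G : Graph) → Subset (n G) → Set
IsVertexMetricGenerator G S =
  ∀ (x x' : Vertex G) → x ≢ x' →
    ∃[ s ] (s ∈ S × ∃[ a ] ∃[ b ] (Dist G s x a × Dist G s x' b × a ≢ b))

IsEdgeMetricGenerator : (G : Graph) → Subset (n G) → Set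
IsEdgeMetricGenerator G S =
  ∀ (e e' : Edge G) → DistinctEdges G e e' →
    ∃[ s ] (s ∈ S × ∃[ a ] ∃[ b ] (EDist G s e a × EDist G s e' b × a ≢ b))

IsMetricDim : (G : Graph) → ℕ → Set
IsMetricDim G d =
  (∃[ S ] (IsVertexMetricGenerator G S × ∣ S ∣ ≡ d))
  × (∀ S → IsVertexMetricGenerator G S → d ≤ ∣ S ∣)

IsEdgeMetricDim : (G : Graph) → ℕ → Set
IsEdgeMetricDim G d =
  (∃[ S ] (IsEdgeMetricGenerator G S × ∣ S ∣ ≡ d))
  × (∀ S → IsEdgeMetricGenerator G S → d ≤ ∣ S ∣)

-- Any set of vertices has at most n = |V(G)| elements, so dim(G) ≤ n and
-- edim(G) ≤ n. When every degree is at least 3, the handshake lemma gives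
-- 3n ≤ 2|E(G)|, hence 2c(G) = 2|E(G)| - 2n + 2 ≥ n + 2.

module Submission where

open import Defs
open import Data.Nat using (ℕ; _≤_; _<_; _*_; _+_)
open import Data.Product using (_×_)

open import Data.Bool using (Bool; true; false; _∧_; T)
open import Data.Bool.Properties using (∧-identityʳ; ∧-zeroʳ; T-≡)
open import Data.Fin as Fin using (Fin; toℕ)
open import Data.Fin.Properties using (toℕ-injective)
open import Data.Fin.Subset using (Subset; ∣_∣)
open import Data.Fin.Subset.Properties using (∣p∣≤n)
open import Data.List using (map; allFin)
import Data.List as List using (tabulate)
open import Data.List.Properties using (map-tabulate)
open import Data.Nat using (zero; suc; _∸_; _<ᵇ_; z≤n)
import Data.Nat.ListAction as ListAction
open import Data.Nat.Properties
open import Algebra.Properties.CommutativeMonoid.Sum +-0-commutativeMonoid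
  using (sum; sum-syntax; sum-cong-≗; ∑-distrib-+; ∑-comm)
open import Data.Nat.Tactic.RingSolver using (solve-∀)
open import Data.Product using (_,_; ∃-syntax)
open import Data.Vec using (tabulate)
open import Function using (_∘_; id; Equivalence)
open import Relation.Binary.PropositionalEquality
  using (_≡_; refl; trans; cong; cong₂; subst; module ≡-Reasoning)
  renaming (sym to ≡-sym)
open import Relation.Nullary using (contradiction)

𝟙 : Bool → ℕ
𝟙 true  = 1
𝟙 false = 0

∣tabulate∣≡∑𝟙 : ∀ {k} (f : Fin k → Bool) → ∣ tabulate f ∣ ≡ ∑[ i < k ] 𝟙 (f i)
∣tabulate∣≡∑𝟙 {zero}  f = refl
∣tabulate∣≡∑𝟙 {suc k} f with f Fin.zero
... | true  = cong suc (∣tabulate∣≡∑𝟙 (f ∘ Fin.suc))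
... | false = ∣tabulate∣≡∑𝟙 (f ∘ Fin.suc)

sum-map-allFin : ∀ {k} (f : Fin k → ℕ) → ListAction.sum (map f (allFin k)) ≡ sum f
sum-map-allFin {k} f = trans (cong ListAction.sum (map-tabulate id f)) (sum-tabulate f)
  where
  sum-tabulate : ∀ {k} (f : Fin k → ℕ) → ListAction.sum (List.tabulate f) ≡ sum f
  sum-tabulate {zero}  f = refl
  sum-tabulate {suc k} f = cong (f Fin.zero +_) (sum-tabulate (f ∘ Fin.suc))

*≤∑ : ∀ {k} c (f : Fin k → ℕ) → (∀ i → c ≤ f i) → k * c ≤ sum f
*≤∑ {zero}  c f c≤f = z≤n
*≤∑ {suc k} c f c≤f = +-mono-≤ (c≤f Fin.zero) (*≤∑ c (f ∘ Fin.suc) (c≤f ∘ Fin.suc))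

module _ (G : Graph) where

  oriented : Vertex G → Vertex G → ℕ
  oriented i j = 𝟙 (adj G i j ∧ (toℕ i <ᵇ toℕ j))

  𝟙-adj≡oriented+oriented : ∀ i j → 𝟙 (adj G i j) ≡ oriented i j + oriented j i
  𝟙-adj≡oriented+oriented i j with toℕ i <ᵇ toℕ j in i<ᵇj | toℕ j <ᵇ toℕ i in j<ᵇi
  ... | true  | true  = contradiction (lt (toℕ i) (toℕ j) i<ᵇj) (<⇒≯ (lt (toℕ j) (toℕ i) j<ᵇi))
    where lt : ∀ a b → (a <ᵇ b) ≡ true → a < b
          lt a b eq = <ᵇ⇒< a b (Equivalence.from T-≡ eq)
  ... | true  | false rewrite ∧-identityʳ (adj G i j) | ∧-zeroʳ (adj G j i) = ≡-sym (+-identityʳ _)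
  ... | false | true  rewrite ∧-zeroʳ (adj G i j) | ∧-identityʳ (adj G j i) = cong 𝟙 (Graph.sym G i j)
  ... | false | false rewrite ∧-zeroʳ (adj G i j) | ∧-zeroʳ (adj G j i) = cong 𝟙 adj≡false
    where ≥ : ∀ {a b} → (a <ᵇ b) ≡ false → b ≤ a
          ≥ eq = ≮⇒≥ (λ a<b → subst T eq (<⇒<ᵇ a<b))
          i≡j : i ≡ j
          i≡j = toℕ-injective (≤-antisym (≥ j<ᵇi) (≥ i<ᵇj))
          adj≡false : adj G i j ≡ false
          adj≡false = subst (λ k → adj G i k ≡ false) i≡j (irrfl G i)

  numEdges≡∑oriented : numEdges G ≡ ∑[ i < n G ] ∑[ j < n G ] oriented i j
  numEdges≡∑oriented = begin
    ListAction.sum (map out-degree (allFin (n G))) ≡⟨ sum-map-allFin out-degree ⟩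
    ∑[ i < n G ] out-degree i                      ≡⟨ sum-cong-≗ (λ i → ∣tabulate∣≡∑𝟙 (λ j → adj G i j ∧ (toℕ i <ᵇ toℕ j))) ⟩
    ∑[ i < n G ] ∑[ j < n G ] oriented i j         ∎
    where
    open ≡-Reasoning
    out-degree : Vertex G → ℕ
    out-degree i = ∣ tabulate (λ j → adj G i j ∧ (toℕ i <ᵇ toℕ j)) ∣

  handshake : ∑[ i < n G ] degree G i ≡ numEdges G + numEdges G
  handshake = begin
    ∑[ i < n G ] degree G i                                    ≡⟨ sum-cong-≗ (λ i → ∣tabulate∣≡∑𝟙 (adj G i)) ⟩
    ∑[ i < n G ] ∑[ j < n G ] 𝟙 (adj G i j)                    ≡⟨ sum-cong-≗ (λ i → sum-cong-≗ (𝟙-adj≡oriented+oriented i)) ⟩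
    ∑[ i < n G ] ∑[ j < n G ] (oriented i j + oriented j i)    ≡⟨ sum-cong-≗ (λ i → ∑-distrib-+ (oriented i) (λ j → oriented j i)) ⟩
    ∑[ i < n G ] (∑[ j < n G ] oriented i j + ∑[ j < n G ] oriented j i)
      ≡⟨ ∑-distrib-+ (λ i → ∑[ j < n G ] oriented i j) (λ i → ∑[ j < n G ] oriented j i) ⟩
    ∑[ i < n G ] ∑[ j < n G ] oriented i j + ∑[ i < n G ] ∑[ j < n G ] oriented j i
      ≡⟨ cong (∑[ i < n G ] ∑[ j < n G ] oriented i j +_) (∑-comm (λ j i → oriented i j)) ⟩
    ∑[ i < n G ] ∑[ j < n G ] oriented i j + ∑[ i < n G ] ∑[ j < n G ] oriented i j
      ≡⟨ cong₂ _+_ (≡-sym numEdges≡∑oriented) (≡-sym numEdges≡∑oriented) ⟩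
    numEdges G + numEdges G                                    ∎
    where open ≡-Reasoning

3n≤2m⇒n+1<2[m+1∸n] : ∀ n m → n * 3 ≤ m + m → n + 1 < 2 * ((m + 1) ∸ n)
3n≤2m⇒n+1<2[m+1∸n] n m 3n≤2m =
  subst (n + 1 <_) (≡-sym (*-distribˡ-∸ 2 (m + 1) n)) (m+n≤o⇒m≤o∸n (suc (n + 1)) bound)
  where
  open ≤-Reasoning
  bound : suc (n + 1) + 2 * n ≤ 2 * (m + 1)
  bound = begin
    suc (n + 1) + 2 * n  ≡⟨ lhs n ⟩
    n * 3 + 2            ≤⟨ +-monoˡ-≤ 2 3n≤2m ⟩
    m + m + 2            ≡⟨ rhs m ⟩
    2 * (m + 1)          ∎
    where
    lhs : ∀ n → suc (n + 1) + 2 * n ≡ n * 3 + 2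
    lhs = solve-∀
    rhs : ∀ m → m + m + 2 ≡ 2 * (m + 1)
    rhs = solve-∀

n+1<2*cyclomatic : (G : Graph) → (∀ v → 3 ≤ degree G v) → n G + 1 < 2 * cyclomatic G
n+1<2*cyclomatic G δ≥3 = 3n≤2m⇒n+1<2[m+1∸n] (n G) (numEdges G)
  (subst (n G * 3 ≤_) (handshake G) (*≤∑ 3 (degree G) δ≥3))

size≤n : ∀ {k d} {P : Subset k → Set} → ∃[ S ] (P S × ∣ S ∣ ≡ d) → d ≤ k
size≤n (S , _ , ∣S∣≡d) = subst (_≤ _) ∣S∣≡d (∣p∣≤n S)

proposition7 : (G : Graph) → Connected G → (∀ v → 3 ≤ degree G v) →
    (∀ d → IsMetricDim G d → d + 1 < 2 * cyclomatic G)
    × (∀ d → IsEdgeMetricDim G d → d + 1 < 2 * cyclomatic G)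
proposition7 G _ δ≥3 =
  (λ d (generator , _) → below generator) , (λ d (generator , _) → below generator)
  where
  below : ∀ {d} {P : Subset (n G) → Set} → ∃[ S ] (P S × ∣ S ∣ ≡ d) → d + 1 < 2 * cyclomatic G
  below generator = ≤-<-trans (+-monoˡ-≤ 1 (size≤n generator)) (n+1<2*cyclomatic G δ≥3)
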